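{- The equations D1: $\tau(\tau x+y)\approx\tau x+y$ and D2: $\alpha(\sum_{i\in I}\tau x_i+y)\approx\sum_{i\in I}\alpha x_i+\alpha(\sum_{i\in I}x_i+y)$ (for every finite index set $I$ and every $\alpha\in A_\tau$) are derivable in equational logic from A1-4 together with WIF1-2.
   Context: $A$ is a nonempty countable set of actions, $\tau\notin A$, $A_\tau=A\cup\{\tau\}$. BCCS($A$) terms: $t::=0\mid x\mid\alpha t\mid t+t$ with $x$ from a countably infinite set of variables, $\alpha\in A_\tau$; $\sum_{i\in I}t_i$ denotes a finite sum, the empty sum being $0$. Equational logic: reflexivity, symmetry, transitivity, substitution instances of axioms, closure under prefix and $+$ contexts. Axioms: A1: $x+y\approx y+x$; A2: $(x+y)+z\approx x+(y+z)$; A3: $x+x\approx x$; A4: $x+0\approx x$; WIF1: $\alpha(\tau x+\tau y)\approx\alpha x+\alpha y$ for each $\alpha\in A_\tau$; WIF2: $\tau x+y\approx\tau x+\tau(x+y)$. -}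

module Defs where

open import Data.Nat using (ℕ)
open import Data.Fin using (Fin; zero; suc)
open import Data.Product using (Σ)
open import Relation.Binary.PropositionalEquality using (_≡_)

data Act (A : Set) : Set where
  τ   : Act A
  act : A → Act A

data Term (A : Set) : Set where
  𝟎    : Term A
  var  : ℕ → Term A
  _·_  : Act A → Term A → Term A
  _⊕_  : Term A → Term A → Term A

infixr 6 _⊕_
infixr 7 _·_

_[_] : {A : Set} → Term A → (ℕ → Term A) → Term A
𝟎 [ σ ] = 𝟎
var x [ σ ] = σ x
(α · t) [ σ ] = α · (t [ σ ])
(t ⊕ u) [ σ ] = (t [ σ ]) ⊕ (u [ σ ])

Sum : {A : Set} (n : ℕ) → (Fin n → Term A) → Term A
Sum ℕ.zero t = 𝟎
Sum (ℕ.suc ℕ.zero) t = t zero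
Sum (ℕ.suc (ℕ.suc n)) t = t zero ⊕ Sum (ℕ.suc n) (λ i → t (suc i))

-- the axiom system A1-4, WIF1-2 (variables x = 0, y = 1, z = 2)
data Axiom {A : Set} : Term A → Term A → Set where
  A1   : Axiom (var 0 ⊕ var 1) (var 1 ⊕ var 0)
  A2   : Axiom ((var 0 ⊕ var 1) ⊕ var 2) (var 0 ⊕ (var 1 ⊕ var 2))
  A3   : Axiom (var 0 ⊕ var 0) (var 0)
  A4   : Axiom (var 0 ⊕ 𝟎) (var 0)
  WIF1 : (α : Act A) → Axiom (α · (τ · var 0 ⊕ τ · var 1)) (α · var 0 ⊕ α · var 1)
  WIF2 : Axiom (τ · var 0 ⊕ var 1) (τ · var 0 ⊕ τ · (var 0 ⊕ var 1))

data _⊢_≈_ {A : Set} (E : Term A → Term A → Set) : Term A → Term A → Set where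
  refl  : ∀ {t} → E ⊢ t ≈ t
  sym   : ∀ {t u} → E ⊢ t ≈ u → E ⊢ u ≈ t
  trans : ∀ {t u v} → E ⊢ t ≈ u → E ⊢ u ≈ v → E ⊢ t ≈ v
  inst  : ∀ {t u} (σ : ℕ → Term A) → E t u → E ⊢ (t [ σ ]) ≈ (u [ σ ])
  pre   : ∀ {t u} (α : Act A) → E ⊢ t ≈ u → E ⊢ (α · t) ≈ (α · u)
  plus  : ∀ {t t' u u'} → E ⊢ t ≈ t' → E ⊢ u ≈ u' → E ⊢ (t ⊕ u) ≈ (t' ⊕ u')

-- A is nonempty and countable
Countable : Set → Set
Countable A = Σ (ℕ → A) Surjective′
  where Surjective′ : (ℕ → A) → Set
        Surjective′ f = ∀ a → Σ ℕ (λ n → f n ≡ a)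

module Submission where

-- D1 follows from WIF2 under the prefix τ, then WIF1, then WIF2 backwards.
-- D2 is proved for arbitrary summands x_i and tail y by induction on |I|:
-- the first τ-summand τ x₀ absorbs the rest via WIF2, WIF1 splits the
-- prefix α over the result, and x₀ is moved into the tail, to which the
-- induction hypothesis applies.

open import Defs
open import Data.Nat using (ℕ)
open import Data.Fin using (Fin; toℕ; zero; suc)
open import Data.Product using (_×_; _,_)
open import Relation.Binary.Bundles using (Setoid)
import Relation.Binary.Reasoning.Setoid as SetoidReasoning

module _ {A : Set} where

  infix 4 _≃_

  _≃_ : Term A → Term A → Set
  t ≃ u = Axiom {A} ⊢ t ≈ u

  provable : Setoid _ _
  provable = record
    { Carrier = Term A
    ; _≈_ = _≃_
    ; isEquivalence = record { refl = refl ; sym = sym ; trans = trans }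
    }

  open SetoidReasoning provable

  assign : Term A → Term A → Term A → ℕ → Term A
  assign a b c 0 = a
  assign a b c 1 = b
  assign a b c _ = c

  +-comm : ∀ a b → a ⊕ b ≃ b ⊕ a
  +-comm a b = inst (assign a b 𝟎) A1

  +-assoc : ∀ a b c → (a ⊕ b) ⊕ c ≃ a ⊕ (b ⊕ c)
  +-assoc a b c = inst (assign a b c) A2

  +-identityʳ : ∀ a → a ⊕ 𝟎 ≃ a
  +-identityʳ a = inst (assign a 𝟎 𝟎) A4

  wif1 : ∀ α a b → α · (τ · a ⊕ τ · b) ≃ α · a ⊕ α · b
  wif1 α a b = inst (assign a b 𝟎) (WIF1 α)

  wif2 : ∀ a b → τ · a ⊕ b ≃ τ · a ⊕ τ · (a ⊕ b)
  wif2 a b = inst (assign a b 𝟎) WIF2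

  +-identityˡ : ∀ a → 𝟎 ⊕ a ≃ a
  +-identityˡ a = trans (+-comm 𝟎 a) (+-identityʳ a)

  +-swapˡ : ∀ a b c → a ⊕ (b ⊕ c) ≃ b ⊕ (a ⊕ c)
  +-swapˡ a b c = begin
    a ⊕ (b ⊕ c)  ≈⟨ +-assoc a b c ⟨
    (a ⊕ b) ⊕ c  ≈⟨ plus (+-comm a b) refl ⟩
    (b ⊕ a) ⊕ c  ≈⟨ +-assoc b a c ⟩
    b ⊕ (a ⊕ c)  ∎

  -- A sum over Fin (1+n) is its first summand plus the sum of the rest;
  -- for n = 0 this needs A4, since Sum 1 f is f zero rather than f zero ⊕ 0.
  Sum-suc : ∀ n (f : Fin (ℕ.suc n) → Term A) →
            Sum (ℕ.suc n) f ≃ f zero ⊕ Sum n (λ i → f (suc i))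
  Sum-suc ℕ.zero      f = sym (+-identityʳ (f zero))
  Sum-suc (ℕ.suc n)   f = refl

  D1 : ∀ x y → τ · (τ · x ⊕ y) ≃ τ · x ⊕ y
  D1 x y = begin
    τ · (τ · x ⊕ y)                ≈⟨ pre τ (wif2 x y) ⟩
    τ · (τ · x ⊕ τ · (x ⊕ y))      ≈⟨ wif1 τ x (x ⊕ y) ⟩
    τ · x ⊕ τ · (x ⊕ y)            ≈⟨ wif2 x y ⟨
    τ · x ⊕ y                      ∎

  D2 : ∀ n (x : Fin n → Term A) (y : Term A) (α : Act A) →
       α · (Sum n (λ i → τ · x i) ⊕ y)
         ≃ Sum n (λ i → α · x i) ⊕ α · (Sum n x ⊕ y)
  D2 ℕ.zero    x y α = sym (+-identityˡ (α · (𝟎 ⊕ y)))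
  D2 (ℕ.suc n) x y α = begin
    α · (Sum (ℕ.suc n) (λ i → τ · x i) ⊕ y)
      ≈⟨ pre α (plus (Sum-suc n (λ i → τ · x i)) refl) ⟩
    α · ((τ · x₀ ⊕ τΣ) ⊕ y)
      ≈⟨ pre α (+-assoc (τ · x₀) τΣ y) ⟩
    α · (τ · x₀ ⊕ (τΣ ⊕ y))
      ≈⟨ pre α (wif2 x₀ (τΣ ⊕ y)) ⟩
    α · (τ · x₀ ⊕ τ · (x₀ ⊕ (τΣ ⊕ y)))
      ≈⟨ wif1 α x₀ (x₀ ⊕ (τΣ ⊕ y)) ⟩
    α · x₀ ⊕ α · (x₀ ⊕ (τΣ ⊕ y))
      ≈⟨ plus refl (pre α (+-swapˡ x₀ τΣ y)) ⟩
    α · x₀ ⊕ α · (τΣ ⊕ (x₀ ⊕ y))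
      ≈⟨ plus refl (D2 n xs (x₀ ⊕ y) α) ⟩
    α · x₀ ⊕ (αΣ ⊕ α · (Σ ⊕ (x₀ ⊕ y)))
      ≈⟨ +-assoc (α · x₀) αΣ _ ⟨
    (α · x₀ ⊕ αΣ) ⊕ α · (Σ ⊕ (x₀ ⊕ y))
      ≈⟨ plus (Sum-suc n (λ i → α · x i)) refl ⟨
    Sum (ℕ.suc n) (λ i → α · x i) ⊕ α · (Σ ⊕ (x₀ ⊕ y))
      ≈⟨ plus refl (pre α tail-regroup) ⟩
    Sum (ℕ.suc n) (λ i → α · x i) ⊕ α · (Sum (ℕ.suc n) x ⊕ y)
      ∎
    where
    x₀ : Term A
    x₀ = x zero
    xs : Fin n → Term A
    xs i = x (suc i)
    τΣ αΣ Σ : Term A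
    τΣ = Sum n (λ i → τ · xs i)
    αΣ = Sum n (λ i → α · xs i)
    Σ  = Sum n xs

    tail-regroup : Σ ⊕ (x₀ ⊕ y) ≃ Sum (ℕ.suc n) x ⊕ y
    tail-regroup = begin
      Σ ⊕ (x₀ ⊕ y)           ≈⟨ +-swapˡ Σ x₀ y ⟩
      x₀ ⊕ (Σ ⊕ y)           ≈⟨ +-assoc x₀ Σ y ⟨
      (x₀ ⊕ Σ) ⊕ y           ≈⟨ plus (Sum-suc n x) refl ⟨
      Sum (ℕ.suc n) x ⊕ y    ∎

lemma3p7 : (A : Set) → A → Countable A →
    (Axiom {A} ⊢ (τ · (τ · var 0 ⊕ var 1)) ≈ (τ · var 0 ⊕ var 1))
    × ((n : ℕ) (α : Act A) →
    Axiom {A} ⊢ (α · (Sum n (λ i → τ · var (toℕ i)) ⊕ var n))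
    ≈ (Sum n (λ i → α · var (toℕ i)) ⊕ α · (Sum n (λ i → var (toℕ i)) ⊕ var n)))
lemma3p7 A _ _ = D1 (var 0) (var 1) , λ n α → D2 n (λ i → var (toℕ i)) (var n) α
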